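{- For every $n\ge1$, \[ \mathrm{URL}_n=\{\mathrm{shape}(\Psi(\sigma)) : \sigma \in \mathrm{And}^{I}_n \}= \{\mathrm{shape}(\Psi(\sigma)) : \sigma \in \mathrm{And}^{II}_n \}= \{\mathrm{shape}(\Psi(\sigma)) : \sigma \in \mathrm{RS}_n \}. \]
   Context: The map $\Psi$ sends a word $\pi$ of distinct integers to a labeled binary tree: empty word to empty tree; otherwise, with $i$ the least letter and $\pi=\sigma i\tau$, the tree has root $i$, left subtree $\Psi(\sigma)$, right subtree $\Psi(\tau)$. $\mathrm{shape}(T)$ is the underlying unlabeled binary tree of $T$. $\mathrm{URL}_n$ is the set of unlabeled rooted binary trees with $n$ vertices in which no vertex has a left child but no right child. André permutations: the empty word and one-letter words are André I and André II; a word $\sigma$ of length $\ge 2$ with $\sigma=\tau\,\min(\sigma)\,\tau'$ is André I (resp. André II) if $\tau,\tau'$ are André I (resp. André II) and the maximum (resp. minimum) letter of $\tau\tau'$ lies in $\tau'$. $\mathrm{And}^{I}_n$, $\mathrm{And}^{II}_n$ denote those which are permutations of $[n]$. A permutation $\sigma$ of $[n]$ is simsun if $\sigma_n=n$ and for each $k=0,\dots,n-1$ the word obtained by deleting the letters $n,n-1,\dots,n-k+1$ has no double descent (index $i$ with $\sigma_i>\sigma_{i+1}>\sigma_{i+2}$); $\mathrm{RS}_n$ is the set of these. -}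

module Defs where

open import Data.Nat using (ℕ; zero; suc; _≤_; _<_; _>_; _⊓_; _≟_)
open import Data.List using (List; []; _∷_; _++_; [_]; length; foldr; break; drop; filter; upTo; map)
open import Data.List.Membership.Propositional using (_∈_)
open import Data.List.Relation.Unary.All using (All)
open import Data.List.Relation.Binary.Permutation.Propositional using (_↭_)
open import Data.Product using (_×_; _,_; ∃; ∃-syntax; Σ-syntax)
open import Data.Unit using (⊤)
open import Data.Empty using (⊥)
open import Relation.Nullary using (¬_)
open import Relation.Binary.PropositionalEquality using (_≡_)
open import Data.Nat using (_≤?_)

data LTree : Set where
  lleaf : LTree
  lnode : LTree → ℕ → LTree → LTree

data Tree : Set where
  leaf : Tree
  node : Tree → Tree → Tree

shape : LTree → Tree
shape lleaf         = leaf
shape (lnode l _ r) = node (shape l) (shape r)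

size : Tree → ℕ
size leaf       = 0
size (node l r) = suc (size l Data.Nat.+ size r)

NoLeftOnly : Tree → Set
NoLeftOnly leaf                 = ⊤
NoLeftOnly (node (node _ _) leaf) = ⊥
NoLeftOnly (node l r)           = NoLeftOnly l × NoLeftOnly r

URL : ℕ → Tree → Set
URL n t = size t ≡ n × NoLeftOnly t

-- The map Ψ : words of distinct integers → labeled binary trees.
-- Implemented with fuel (the length of the word suffices).

ψ : ℕ → List ℕ → LTree
ψ zero    _        = lleaf
ψ (suc f) []       = lleaf
ψ (suc f) (x ∷ xs) with break (_≟ m) (x ∷ xs)
  where m = foldr _⊓_ x xs
... | (σ , τ) = lnode (ψ f σ) (foldr _⊓_ x xs) (ψ f (drop 1 τ))

Ψ : List ℕ → LTree
Ψ π = ψ (length π) π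

IsPerm : ℕ → List ℕ → Set
IsPerm n σ = σ ↭ map suc (upTo n)

data AndreI : List ℕ → Set where
  andreI-nil    : AndreI []
  andreI-single : ∀ a → AndreI [ a ]
  andreI-split  : ∀ τ m τ' →
                  All (m <_) (τ ++ τ') →
                  AndreI τ → AndreI τ' →
                  (∃[ x ] (x ∈ τ' × All (_≤ x) (τ ++ τ'))) →
                  AndreI (τ ++ m ∷ τ')

data AndreII : List ℕ → Set where
  andreII-nil    : AndreII []
  andreII-single : ∀ a → AndreII [ a ]
  andreII-split  : ∀ τ m τ' →
                   All (m <_) (τ ++ τ') →
                   AndreII τ → AndreII τ' →
                   (∃[ x ] (x ∈ τ' × All (x ≤_) (τ ++ τ'))) →
                   AndreII (τ ++ m ∷ τ')

NoDoubleDescent : List ℕ → Set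
NoDoubleDescent (a ∷ b ∷ c ∷ rest) = ¬ (a > b × b > c) × NoDoubleDescent (b ∷ c ∷ rest)
NoDoubleDescent _                  = ⊤

-- σ ∈ RS_n  (σ a permutation of [n]):  σ_n = n, and for each k = 0,…,n-1,
-- deleting the letters n, n-1, …, n-k+1 (i.e. keeping letters ≤ n-k)
-- leaves a word with no double descent.
Simsun : ℕ → List ℕ → Set
Simsun n σ = IsPerm n σ
           × (∃[ τ ] (σ ≡ τ ++ [ n ]))
           × (∀ k → k < n → NoDoubleDescent (filter (_≤? (n Data.Nat.∸ k)) σ))

{-# OPTIONS --safe #-}
-- If m is smaller than every letter of σ and τ then Ψ (σ ++ m ∷ τ) = lnode (Ψ σ) m (Ψ τ), so
-- shape (Ψ π) has a vertex with a left child and no right child exactly when some letter of π is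
-- preceded by a larger letter and is either last or followed by a smaller one, i.e. when π 0 has a
-- double descent. André words split with a nonempty right factor, and a simsun permutation has no
-- double descent and ends with its maximum, so all of them give trees in URL. Conversely a tree in
-- URL is the shape of the in-order reading of any increasing labelling of it: preorder labels give
-- an André I word, preorder labels visiting right subtrees first give an André II word, and André II
-- words on the left subtrees along the right spine give a simsun permutation, because deleting the
-- largest letters of an André II word w never creates a double descent in w 0.
module Submission where

open import Defs
open import Data.Nat using (ℕ; _≥_)
open import Data.List using (List)
open import Data.Product using (_×_; ∃-syntax)
open import Function.Bundles using (_⇔_)
open import Relation.Binary.PropositionalEquality using (_≡_)

open import Data.Nat using (zero; suc; _+_; _∸_; _≤_; _<_; _⊓_; _≟_; _≤?_; s≤s⁻¹; z<s)
open import Data.Nat.Properties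
open import Data.List using ([]; _∷_; _++_; [_]; length; foldr; break; span; filter; upTo; applyUpTo)
open import Data.List.Properties
  using (foldr-preservesᵇ; foldr-preservesʳ; foldr-forcesᵇ; length-++; length-map; length-upTo; map-upTo;
         ++-assoc; filter-++; filter-accept; filter-none; filter-all)
open import Data.List.Relation.Unary.All as All using (All; []; _∷_)
open import Data.List.Relation.Unary.All.Properties using (++⁺; ++⁻ˡ; ++⁻ʳ; filter⁺)
open import Data.List.Relation.Unary.Any using (here; there)
import Data.List.Relation.Unary.First as First
open import Data.List.Relation.Unary.First.Properties using (¬All⇒First; toView)
open import Data.List.Membership.Propositional using (_∈_)
open import Data.List.Membership.Propositional.Properties using (∈-++⁺ʳ; ∈-filter⁺)
open import Data.List.Relation.Binary.Permutation.Propositional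
  using (_↭_; ↭-refl; ↭-sym; ↭-trans; ↭-reflexive; prep)
open import Data.List.Relation.Binary.Permutation.Propositional.Properties
  using (All-resp-↭; ∈-resp-↭; shift; ++-comm; ↭-length)
import Data.List.Relation.Binary.Permutation.Propositional.Properties as ↭
open import Data.Product using (_,_; proj₁; proj₂; map₁; uncurry)
open import Data.Sum using (_⊎_; inj₁; inj₂; [_,_]′)
open import Data.Unit using (⊤; tt)
open import Data.Empty using (⊥-elim)
open import Function using (_∘_)
open import Function.Bundles using (mk⇔; Equivalence)
open import Relation.Nullary using (¬_; ¬?; contradiction; yes; no)
open import Relation.Nullary.Decidable using (dec-true; dec-false; decidable-stable)
open import Relation.Unary using (Decidable)
open import Relation.Binary.PropositionalEquality
  using (_≢_; ≢-sym; refl; sym; trans; cong; cong₂; subst; module ≡-Reasoning)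

foldr-⊓-∈ : ∀ x xs → foldr _⊓_ x xs ∈ x ∷ xs
foldr-⊓-∈ x xs = foldr-preservesᵇ {P = _∈ x ∷ xs} ⊓-∈ (here refl) (All.tabulate there)
  where
  ⊓-∈ : ∀ {a b} → a ∈ x ∷ xs → b ∈ x ∷ xs → a ⊓ b ∈ x ∷ xs
  ⊓-∈ {a} {b} a∈ b∈ = [ (λ eq → subst (_∈ x ∷ xs) (sym eq) a∈) , (λ eq → subst (_∈ x ∷ xs) (sym eq) b∈) ]′ (⊓-sel a b)

foldr-⊓-≤ : ∀ x xs → All (foldr _⊓_ x xs ≤_) (x ∷ xs)
foldr-⊓-≤ x xs =
  foldr-preservesʳ {P = _≤ x} (λ a → ≤-trans (m⊓n≤n a _)) ≤-refl xs
  ∷ foldr-forcesᵇ (λ a b le → m≤n⊓o⇒m≤n a b le , m≤n⊓o⇒m≤o a b le) x xs ≤-refl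

foldr-⊓≡ : ∀ {m} x xs → m ∈ x ∷ xs → All (m ≤_) (x ∷ xs) → foldr _⊓_ x xs ≡ m
foldr-⊓≡ x xs m∈ m≤ = ≤-antisym (All.lookup (foldr-⊓-≤ x xs) m∈) (All.lookup m≤ (foldr-⊓-∈ x xs))

span-++ : ∀ {P : ℕ → Set} (P? : Decidable P) {σ m τ} → All P σ → ¬ P m → span P? (σ ++ m ∷ τ) ≡ (σ , m ∷ τ)
span-++ P? {m = m} [] ¬Pm rewrite dec-false (P? m) ¬Pm = refl
span-++ P? {x ∷ σ} (Px ∷ Pσ) ¬Pm rewrite dec-true (P? x) Px = cong (map₁ (x ∷_)) (span-++ P? Pσ ¬Pm)

first-occurrence : ∀ {m π} → m ∈ π → ∃[ σ ] ∃[ τ ] (π ≡ σ ++ m ∷ τ × All (_≢ m) σ)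
first-occurrence {m} m∈
  with toView (¬All⇒First (λ x → ¬? (x ≟ m)) (decidable-stable (_ ≟ m)) (λ ≢m → All.lookup ≢m m∈ refl))
... | ≢m First.++ refl ∷ τ = _ , τ , refl , ≢m

min-split : ∀ x xs → ∃[ σ ] ∃[ m ] ∃[ τ ] (x ∷ xs ≡ σ ++ m ∷ τ × All (m <_) σ × All (m ≤_) τ)
min-split x xs with first-occurrence (foldr-⊓-∈ x xs)
... | σ , τ , eq , ≢min =
  σ , _ , τ , eq , All.zipWith (uncurry ≤∧≢⇒<) (++⁻ˡ σ lower , All.map ≢-sym ≢min) , All.tail (++⁻ʳ σ lower)
  where lower = subst (All (foldr _⊓_ x xs ≤_)) eq (foldr-⊓-≤ x xs)

length-split : ∀ σ {m : ℕ} τ → length (σ ++ m ∷ τ) ≡ suc (length σ + length τ)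
length-split σ τ = trans (length-++ σ) (+-suc (length σ) (length τ))

length-split-≤ : ∀ {n} σ {m : ℕ} τ → length (σ ++ m ∷ τ) ≤ suc n → length σ ≤ n × length τ ≤ n
length-split-≤ σ τ le with s≤s⁻¹ (subst (_≤ _) (length-split σ τ) le)
... | le' = ≤-trans (m≤m+n _ _) le' , ≤-trans (m≤n+m _ _) le'

min-split-induction : (P : List ℕ → Set) → P [] →
  (∀ {σ m τ} → All (m <_) σ → All (m ≤_) τ → P σ → P τ → P (σ ++ m ∷ τ)) → ∀ π → P π
min-split-induction P P[] P-split π = go (length π) π ≤-refl
  where
  go : ∀ n π → length π ≤ n → P π
  go n [] _ = P[]
  go (suc n) (x ∷ xs) le with min-split x xs
  ... | σ , m , τ , eq , σ> , τ≥ with length-split-≤ σ τ (subst (λ π → length π ≤ suc n) eq le)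
  ... | σ≤ , τ≤ = subst P (sym eq) (P-split σ> τ≥ (go n σ σ≤) (go n τ τ≤))

ψ-∷ : ∀ f x xs {σ m τ} → foldr _⊓_ x xs ≡ m → break (_≟ m) (x ∷ xs) ≡ (σ , m ∷ τ) →
      ψ (suc f) (x ∷ xs) ≡ lnode (ψ f σ) m (ψ f τ)
ψ-∷ f x xs refl eq rewrite eq = refl

ψ-∷-split : ∀ f x xs {σ m τ} → x ∷ xs ≡ σ ++ m ∷ τ → All (m <_) σ → All (m ≤_) τ →
            ψ (suc f) (x ∷ xs) ≡ lnode (ψ f σ) m (ψ f τ)
ψ-∷-split f x xs {σ} {m} {τ} eq σ> τ≥ = ψ-∷ f x xs
  (foldr-⊓≡ x xs (subst (m ∈_) (sym eq) (∈-++⁺ʳ σ (here refl)))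
                (subst (All (m ≤_)) (sym eq) (++⁺ (All.map <⇒≤ σ>) (≤-refl ∷ τ≥))))
  (trans (cong (break (_≟ m)) eq) (span-++ (λ x → ¬? (x ≟ m)) (All.map >⇒≢ σ>) (λ m≢m → m≢m refl)))

ψ-split : ∀ f {σ m τ} → All (m <_) σ → All (m ≤_) τ → ψ (suc f) (σ ++ m ∷ τ) ≡ lnode (ψ f σ) m (ψ f τ)
ψ-split f {[]}    = ψ-∷-split f _ _ refl
ψ-split f {_ ∷ _} = ψ-∷-split f _ _ refl

ψ-[] : ∀ f → ψ f [] ≡ lleaf
ψ-[] zero    = refl
ψ-[] (suc f) = refl

fuel-split : ∀ {f} σ {m : ℕ} τ → length (σ ++ m ∷ τ) ≤ f → ∃[ f' ] (f ≡ suc f' × length σ ≤ f' × length τ ≤ f')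
fuel-split {zero}  σ τ le with () ← subst (_≤ 0) (length-split σ τ) le
fuel-split {suc f} σ τ le = f , refl , length-split-≤ σ τ le

ψ-fuel-irrelevant : ∀ π {f g} → length π ≤ f → length π ≤ g → ψ f π ≡ ψ g π
ψ-fuel-irrelevant = min-split-induction _ (λ {f} {g} _ _ → trans (ψ-[] f) (sym (ψ-[] g))) split
  where
  split : ∀ {σ m τ} → All (m <_) σ → All (m ≤_) τ →
          (∀ {f g} → length σ ≤ f → length σ ≤ g → ψ f σ ≡ ψ g σ) →
          (∀ {f g} → length τ ≤ f → length τ ≤ g → ψ f τ ≡ ψ g τ) →
          ∀ {f g} → length (σ ++ m ∷ τ) ≤ f → length (σ ++ m ∷ τ) ≤ g →
          ψ f (σ ++ m ∷ τ) ≡ ψ g (σ ++ m ∷ τ)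
  split {σ} {m} {τ} σ> τ≥ ihσ ihτ le₁ le₂ with fuel-split σ τ le₁ | fuel-split σ τ le₂
  ... | f , refl , σ≤f , τ≤f | g , refl , σ≤g , τ≤g = begin
    ψ (suc f) (σ ++ m ∷ τ)     ≡⟨ ψ-split f σ> τ≥ ⟩
    lnode (ψ f σ) m (ψ f τ)    ≡⟨ cong₂ (λ l r → lnode l m r) (ihσ σ≤f σ≤g) (ihτ τ≤f τ≤g) ⟩
    lnode (ψ g σ) m (ψ g τ)    ≡⟨ ψ-split g σ> τ≥ ⟨
    ψ (suc g) (σ ++ m ∷ τ)     ∎
    where open ≡-Reasoning

Ψ-split : ∀ {σ m τ} → All (m <_) σ → All (m ≤_) τ → Ψ (σ ++ m ∷ τ) ≡ lnode (Ψ σ) m (Ψ τ)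
Ψ-split {σ} {m} {τ} σ> τ≥ = begin
  Ψ (σ ++ m ∷ τ)                   ≡⟨ ψ-fuel-irrelevant (σ ++ m ∷ τ) ≤-refl (≤-reflexive (length-split σ τ)) ⟩
  ψ (suc L) (σ ++ m ∷ τ)           ≡⟨ ψ-split L σ> τ≥ ⟩
  lnode (ψ L σ) m (ψ L τ)          ≡⟨ cong₂ (λ l r → lnode l m r) (ψ-fuel-irrelevant σ (m≤m+n _ _) ≤-refl)
                                                                   (ψ-fuel-irrelevant τ (m≤n+m _ _) ≤-refl) ⟩
  lnode (Ψ σ) m (Ψ τ)              ∎
  where
  open ≡-Reasoning
  L = length σ + length τ

size-shape-Ψ : ∀ π → size (shape (Ψ π)) ≡ length π
size-shape-Ψ = min-split-induction _ refl split
  where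
  split : ∀ {σ m τ} → All (m <_) σ → All (m ≤_) τ →
          size (shape (Ψ σ)) ≡ length σ → size (shape (Ψ τ)) ≡ length τ →
          size (shape (Ψ (σ ++ m ∷ τ))) ≡ length (σ ++ m ∷ τ)
  split {σ} {m} {τ} σ> τ≥ ihσ ihτ = begin
    size (shape (Ψ (σ ++ m ∷ τ)))             ≡⟨ cong (size ∘ shape) (Ψ-split σ> τ≥) ⟩
    suc (size (shape (Ψ σ)) + size (shape (Ψ τ))) ≡⟨ cong suc (cong₂ _+_ ihσ ihτ) ⟩
    suc (length σ + length τ)                 ≡⟨ length-split σ τ ⟨
    length (σ ++ m ∷ τ)                       ∎
    where open ≡-Reasoning

NoLeftOnly-node⁺ : ∀ {l r} → NoLeftOnly l → NoLeftOnly r → (r ≡ leaf → l ≡ leaf) → NoLeftOnly (node l r)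
NoLeftOnly-node⁺ {leaf}              _  nr _ = tt , nr
NoLeftOnly-node⁺ {node _ _} {leaf}   _  _  r≡leaf⇒l≡leaf with () ← r≡leaf⇒l≡leaf refl
NoLeftOnly-node⁺ {node _ _} {node _ _} nl nr _ = nl , nr

NoLeftOnly-node⁻ : ∀ {l r} → NoLeftOnly (node l r) → NoLeftOnly l × NoLeftOnly r × (r ≡ leaf → l ≡ leaf)
NoLeftOnly-node⁻ {leaf}                (_ , nr)  = tt , nr , λ _ → refl
NoLeftOnly-node⁻ {node _ _} {leaf}     ()
NoLeftOnly-node⁻ {node _ _} {node _ _} (nl , nr) = nl , nr , λ ()

shape-Ψ≡leaf : ∀ {π} → shape (Ψ π) ≡ leaf → π ≡ []
shape-Ψ≡leaf {[]}    _ = refl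
shape-Ψ≡leaf {_ ∷ _} ()

NoLeftOnly-Ψ-split : ∀ {σ m τ} → All (m <_) σ → All (m ≤_) τ →
  NoLeftOnly (shape (Ψ σ)) → NoLeftOnly (shape (Ψ τ)) → (τ ≡ [] → σ ≡ []) →
  NoLeftOnly (shape (Ψ (σ ++ m ∷ τ)))
NoLeftOnly-Ψ-split σ> τ≥ nσ nτ τ≡[]⇒σ≡[] = subst (NoLeftOnly ∘ shape) (sym (Ψ-split σ> τ≥))
  (NoLeftOnly-node⁺ nσ nτ (cong (shape ∘ Ψ) ∘ τ≡[]⇒σ≡[] ∘ shape-Ψ≡leaf))

∈⇒≢[] : ∀ {x : ℕ} {xs} → x ∈ xs → xs ≢ []
∈⇒≢[] () refl

AndreI⇒NoLeftOnly : ∀ {σ} → AndreI σ → NoLeftOnly (shape (Ψ σ))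
AndreI⇒NoLeftOnly andreI-nil        = tt
AndreI⇒NoLeftOnly (andreI-single _) = tt , tt
AndreI⇒NoLeftOnly (andreI-split τ _ _ m< aτ aτ' (_ , x∈ , _)) =
  NoLeftOnly-Ψ-split (++⁻ˡ τ m<) (All.map <⇒≤ (++⁻ʳ τ m<))
    (AndreI⇒NoLeftOnly aτ) (AndreI⇒NoLeftOnly aτ') (⊥-elim ∘ ∈⇒≢[] x∈)

AndreII⇒NoLeftOnly : ∀ {σ} → AndreII σ → NoLeftOnly (shape (Ψ σ))
AndreII⇒NoLeftOnly andreII-nil        = tt
AndreII⇒NoLeftOnly (andreII-single _) = tt , tt
AndreII⇒NoLeftOnly (andreII-split τ _ _ m< aτ aτ' (_ , x∈ , _)) =
  NoLeftOnly-Ψ-split (++⁻ˡ τ m<) (All.map <⇒≤ (++⁻ʳ τ m<))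
    (AndreII⇒NoLeftOnly aτ) (AndreII⇒NoLeftOnly aτ') (⊥-elim ∘ ∈⇒≢[] x∈)

NoFinalDescent : List ℕ → Set
NoFinalDescent (a ∷ b ∷ [])    = a ≤ b
NoFinalDescent (_ ∷ b ∷ c ∷ w) = NoFinalDescent (b ∷ c ∷ w)
NoFinalDescent _               = ⊤

-- Equivalently: the word followed by a letter smaller than all of its letters has no double descent.
NoDoubleDescent₀ : List ℕ → Set
NoDoubleDescent₀ w = NoDoubleDescent w × NoFinalDescent w

NoDoubleDescent-∷⁻ : ∀ a w → NoDoubleDescent (a ∷ w) → NoDoubleDescent w
NoDoubleDescent-∷⁻ _ []          _       = tt
NoDoubleDescent-∷⁻ _ (_ ∷ [])    _       = tt
NoDoubleDescent-∷⁻ _ (_ ∷ _ ∷ _) (_ , d) = d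

NoDoubleDescent-++⁻ˡ : ∀ xs {ys} → NoDoubleDescent (xs ++ ys) → NoDoubleDescent xs
NoDoubleDescent-++⁻ˡ []              _       = tt
NoDoubleDescent-++⁻ˡ (_ ∷ [])        _       = tt
NoDoubleDescent-++⁻ˡ (_ ∷ _ ∷ [])    _       = tt
NoDoubleDescent-++⁻ˡ (_ ∷ b ∷ c ∷ w) (h , d) = h , NoDoubleDescent-++⁻ˡ (b ∷ c ∷ w) d

NoDoubleDescent-++⁻ʳ : ∀ xs {ys} → NoDoubleDescent (xs ++ ys) → NoDoubleDescent ys
NoDoubleDescent-++⁻ʳ []       d = d
NoDoubleDescent-++⁻ʳ (x ∷ xs) {ys} d = NoDoubleDescent-++⁻ʳ xs (NoDoubleDescent-∷⁻ x (xs ++ ys) d)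

NoDoubleDescent-∷ : ∀ {m τ} → All (m <_) τ → NoDoubleDescent τ → NoDoubleDescent (m ∷ τ)
NoDoubleDescent-∷ {τ = []}        _         _ = tt
NoDoubleDescent-∷ {τ = _ ∷ []}    _         _ = tt
NoDoubleDescent-∷ {τ = _ ∷ _ ∷ _} (m<y ∷ _) d = (λ (m>y , _) → <-asym m<y m>y) , d

NoFinalDescent-∷⁻ : ∀ a w → NoFinalDescent (a ∷ w) → NoFinalDescent w
NoFinalDescent-∷⁻ _ []          _ = tt
NoFinalDescent-∷⁻ _ (_ ∷ [])    _ = tt
NoFinalDescent-∷⁻ _ (_ ∷ _ ∷ _) f = f

NoFinalDescent-++⁻ʳ : ∀ xs {ys} → NoFinalDescent (xs ++ ys) → NoFinalDescent ys
NoFinalDescent-++⁻ʳ []       f = f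
NoFinalDescent-++⁻ʳ (x ∷ xs) {ys} f = NoFinalDescent-++⁻ʳ xs (NoFinalDescent-∷⁻ x (xs ++ ys) f)

NoFinalDescent-++⁺ : ∀ xs {a b w} → NoFinalDescent (a ∷ b ∷ w) → NoFinalDescent (xs ++ a ∷ b ∷ w)
NoFinalDescent-++⁺ []              f = f
NoFinalDescent-++⁺ (_ ∷ [])        f = f
NoFinalDescent-++⁺ (_ ∷ _ ∷ [])    f = f
NoFinalDescent-++⁺ (_ ∷ y ∷ z ∷ w) f = NoFinalDescent-++⁺ (y ∷ z ∷ w) f

NoFinalDescent-∷ʳ-max : ∀ {τ x} → All (_≤ x) τ → NoFinalDescent (τ ++ [ x ])
NoFinalDescent-∷ʳ-max {[]}            _             = tt
NoFinalDescent-∷ʳ-max {_ ∷ []}        (a≤x ∷ [])    = a≤x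
NoFinalDescent-∷ʳ-max {_ ∷ _ ∷ []}    (_ ∷ b≤x ∷ _) = b≤x
NoFinalDescent-∷ʳ-max {_ ∷ b ∷ c ∷ τ} (_ ∷ ≤x)      = NoFinalDescent-∷ʳ-max {b ∷ c ∷ τ} ≤x

NoFinalDescent-∷ʳ-min : ∀ {σ m} → All (m <_) σ → NoFinalDescent (σ ++ [ m ]) → σ ≡ []
NoFinalDescent-∷ʳ-min {[]}        _           _   = refl
NoFinalDescent-∷ʳ-min {_ ∷ []}    (m<a ∷ [])  a≤m = contradiction a≤m (<⇒≱ m<a)
NoFinalDescent-∷ʳ-min {a ∷ b ∷ σ} {m} (_ ∷ m<) f
  with () ← NoFinalDescent-∷ʳ-min {b ∷ σ} m< (NoFinalDescent-∷⁻ a (b ∷ σ ++ [ m ]) f)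

NoDoubleDescent-before-min : ∀ {σ m τ} → All (m <_) σ → NoDoubleDescent (σ ++ m ∷ τ) → NoFinalDescent σ
NoDoubleDescent-before-min {[]}            _               _       = tt
NoDoubleDescent-before-min {_ ∷ []}        _               _       = tt
NoDoubleDescent-before-min {_ ∷ _ ∷ []}    (_ ∷ m<b ∷ [])  (h , _) = ≮⇒≥ (λ b<a → h (b<a , m<b))
NoDoubleDescent-before-min {_ ∷ b ∷ c ∷ σ} (_ ∷ m<)        (_ , d) = NoDoubleDescent-before-min {b ∷ c ∷ σ} m< d

NoDoubleDescent-split⁺ : ∀ {σ m τ} → NoDoubleDescent₀ σ → NoDoubleDescent τ → All (m <_) τ →
                         NoDoubleDescent (σ ++ m ∷ τ)
NoDoubleDescent-split⁺ {[]}                         _               d m<τ = NoDoubleDescent-∷ m<τ d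
NoDoubleDescent-split⁺ {_ ∷ []}        {τ = []}     _               _ _   = tt
NoDoubleDescent-split⁺ {_ ∷ []}        {τ = _ ∷ _}  _               d (m<y ∷ m<τ) =
  (λ (_ , y<m) → <-asym m<y y<m) , NoDoubleDescent-∷ (m<y ∷ m<τ) d
NoDoubleDescent-split⁺ {_ ∷ b ∷ []}                 (_ , a≤b)       d m<τ =
  (λ (b<a , _) → ≤⇒≯ a≤b b<a) , NoDoubleDescent-split⁺ {b ∷ []} (tt , tt) d m<τ
NoDoubleDescent-split⁺ {_ ∷ b ∷ c ∷ σ}              ((h , dσ) , fσ) d m<τ =
  h , NoDoubleDescent-split⁺ {b ∷ c ∷ σ} (dσ , fσ) d m<τ

NoFinalDescent-split⁺ : ∀ σ {m τ} → NoFinalDescent τ → All (m <_) τ → (τ ≡ [] → σ ≡ []) →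
                        NoFinalDescent (σ ++ m ∷ τ)
NoFinalDescent-split⁺ σ {τ = []}        _ _          τ≡[]⇒σ≡[] with refl ← τ≡[]⇒σ≡[] refl = tt
NoFinalDescent-split⁺ σ {τ = _ ∷ []}    _ (m<y ∷ []) _ = NoFinalDescent-++⁺ σ (<⇒≤ m<y)
NoFinalDescent-split⁺ σ {τ = _ ∷ _ ∷ _} f _          _ = NoFinalDescent-++⁺ σ f

NoDoubleDescent₀-split⁺ : ∀ {σ m τ} → NoDoubleDescent₀ σ → NoDoubleDescent₀ τ → All (m <_) τ →
                          (τ ≡ [] → σ ≡ []) → NoDoubleDescent₀ (σ ++ m ∷ τ)
NoDoubleDescent₀-split⁺ {σ} dσ (d , f) m<τ c = NoDoubleDescent-split⁺ dσ d m<τ , NoFinalDescent-split⁺ σ f m<τ c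

NoDoubleDescent₀-split⁻ : ∀ {σ m τ} → All (m <_) σ → NoDoubleDescent₀ (σ ++ m ∷ τ) →
                          NoDoubleDescent₀ σ × NoDoubleDescent₀ τ × (τ ≡ [] → σ ≡ [])
NoDoubleDescent₀-split⁻ {σ} {m} {τ} m<σ (d , f) =
  (NoDoubleDescent-++⁻ˡ σ d , NoDoubleDescent-before-min m<σ d) ,
  (NoDoubleDescent-∷⁻ m τ (NoDoubleDescent-++⁻ʳ σ d) , NoFinalDescent-∷⁻ m τ (NoFinalDescent-++⁻ʳ σ f)) ,
  λ { refl → NoFinalDescent-∷ʳ-min m<σ f }

NoDoubleDescent₀⇒NoLeftOnly : ∀ π → NoDoubleDescent₀ π → NoLeftOnly (shape (Ψ π))
NoDoubleDescent₀⇒NoLeftOnly = min-split-induction _ (λ _ → tt) split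
  where
  split : ∀ {σ m τ} → All (m <_) σ → All (m ≤_) τ →
          (NoDoubleDescent₀ σ → NoLeftOnly (shape (Ψ σ))) → (NoDoubleDescent₀ τ → NoLeftOnly (shape (Ψ τ))) →
          NoDoubleDescent₀ (σ ++ m ∷ τ) → NoLeftOnly (shape (Ψ (σ ++ m ∷ τ)))
  split m<σ m≤τ ihσ ihτ d with NoDoubleDescent₀-split⁻ m<σ d
  ... | dσ , dτ , c = NoLeftOnly-Ψ-split m<σ m≤τ (ihσ dσ) (ihτ dτ) c

interval : ℕ → ℕ → List ℕ
interval k zero    = []
interval k (suc s) = k ∷ interval (suc k) s

interval-++ : ∀ k a b → interval k (a + b) ≡ interval k a ++ interval (k + a) b
interval-++ k zero    b = cong (λ j → interval j b) (sym (+-identityʳ k))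
interval-++ k (suc a) b = cong (k ∷_) (trans (interval-++ (suc k) a b)
                                             (cong (λ j → interval (suc k) a ++ interval j b) (sym (+-suc k a))))

interval-≥ : ∀ k s → All (k ≤_) (interval k s)
interval-≥ k zero    = []
interval-≥ k (suc s) = ≤-refl ∷ All.map <⇒≤ (interval-≥ (suc k) s)

interval-< : ∀ k s → All (_< k + s) (interval k s)
interval-< k zero    = []
interval-< k (suc s) =
  m<m+n k z<s ∷ subst (λ b → All (_< b) (interval (suc k) s)) (sym (+-suc k s)) (interval-< (suc k) s)

interval-last : ∀ k s → k + s ∈ interval k (suc s)
interval-last k zero    = here (+-identityʳ k)
interval-last k (suc s) = there (subst (_∈ interval (suc k) (suc s)) (sym (+-suc k s)) (interval-last (suc k) s))

applyUpTo-interval : ∀ {f} k n → (∀ i → f i ≡ k + i) → applyUpTo f n ≡ interval k n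
applyUpTo-interval k zero    _   = refl
applyUpTo-interval k (suc n) f≗ = cong₂ _∷_ (trans (f≗ 0) (+-identityʳ k))
                                             (applyUpTo-interval (suc k) n (λ i → trans (f≗ (suc i)) (+-suc k i)))

IsPerm⇔↭-interval : ∀ {n w} → IsPerm n w ⇔ (w ↭ interval 1 n)
IsPerm⇔↭-interval {n} = mk⇔ (λ p → ↭-trans p (↭-reflexive eq)) (λ p → ↭-trans p (↭-reflexive (sym eq)))
  where eq = trans (map-upTo suc n) (applyUpTo-interval 1 n λ _ → refl)

↭-interval-++ : ∀ {xs ys k a b} → xs ↭ interval k a → ys ↭ interval (k + a) b → xs ++ ys ↭ interval k (a + b)
↭-interval-++ {k = k} {a} {b} p q = ↭-trans (↭.++⁺ p q) (↭-reflexive (sym (interval-++ k a b)))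

↭-interval-node : ∀ {xs ys k s} → xs ++ ys ↭ interval (suc k) s → xs ++ k ∷ ys ↭ interval k (suc s)
↭-interval-node {xs} {ys} {k} p = ↭-trans (shift k xs ys) (prep k p)

↭-interval-≥ : ∀ {w k s} → w ↭ interval k s → All (k ≤_) w
↭-interval-≥ {k = k} {s} p = All-resp-↭ (↭-sym p) (interval-≥ k s)

↭-interval-< : ∀ {w k s} → w ↭ interval k s → All (_< k + s) w
↭-interval-< {k = k} {s} p = All-resp-↭ (↭-sym p) (interval-< k s)

↭-interval-> : ∀ {w k s} a → w ↭ interval (suc k + a) s → All (k <_) w
↭-interval-> {k = k} a p = All.map (≤-trans (m≤m+n (suc k) a)) (↭-interval-≥ p)

shape-Ψ-node : ∀ {k xs ys} → All (k <_) xs → All (k <_) ys →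
               shape (Ψ (xs ++ k ∷ ys)) ≡ node (shape (Ψ xs)) (shape (Ψ ys))
shape-Ψ-node k<xs k<ys = cong shape (Ψ-split k<xs (All.map <⇒≤ k<ys))

andreI-word : Tree → ℕ → List ℕ
andreI-word leaf       k = []
andreI-word (node l r) k = andreI-word l (suc k) ++ k ∷ andreI-word r (suc k + size l)

andreII-word : Tree → ℕ → List ℕ
andreII-word leaf       k = []
andreII-word (node l r) k = andreII-word l (suc k + size r) ++ k ∷ andreII-word r (suc k)

simsun-word : Tree → ℕ → List ℕ
simsun-word leaf       k = []
simsun-word (node l r) k = andreII-word l (suc k) ++ k ∷ simsun-word r (suc k + size l)

andreI-word-↭ : ∀ t k → andreI-word t k ↭ interval k (size t)
andreI-word-↭ leaf       k = ↭-refl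
andreI-word-↭ (node l r) k =
  ↭-interval-node (↭-interval-++ (andreI-word-↭ l (suc k)) (andreI-word-↭ r (suc k + size l)))

andreII-word-↭ : ∀ t k → andreII-word t k ↭ interval k (size t)
andreII-word-↭ leaf       k = ↭-refl
andreII-word-↭ (node l r) k = ↭-interval-node (↭-trans (++-comm wl wr)
  (subst (wr ++ wl ↭_) (cong (interval (suc k)) (+-comm (size r) (size l)))
    (↭-interval-++ (andreII-word-↭ r (suc k)) (andreII-word-↭ l (suc k + size r)))))
  where
  wl = andreII-word l (suc k + size r)
  wr = andreII-word r (suc k)

simsun-word-↭ : ∀ t k → simsun-word t k ↭ interval k (size t)
simsun-word-↭ leaf       k = ↭-refl
simsun-word-↭ (node l r) k =
  ↭-interval-node (↭-interval-++ (andreII-word-↭ l (suc k)) (simsun-word-↭ r (suc k + size l)))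

shape-andreI-word : ∀ t k → shape (Ψ (andreI-word t k)) ≡ t
shape-andreI-word leaf       k = refl
shape-andreI-word (node l r) k = trans
  (shape-Ψ-node (↭-interval-≥ (andreI-word-↭ l (suc k))) (↭-interval-> (size l) (andreI-word-↭ r _)))
  (cong₂ node (shape-andreI-word l (suc k)) (shape-andreI-word r _))

shape-andreII-word : ∀ t k → shape (Ψ (andreII-word t k)) ≡ t
shape-andreII-word leaf       k = refl
shape-andreII-word (node l r) k = trans
  (shape-Ψ-node (↭-interval-> (size r) (andreII-word-↭ l _)) (↭-interval-≥ (andreII-word-↭ r (suc k))))
  (cong₂ node (shape-andreII-word l _) (shape-andreII-word r (suc k)))

shape-simsun-word : ∀ t k → shape (Ψ (simsun-word t k)) ≡ t
shape-simsun-word leaf       k = refl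
shape-simsun-word (node l r) k = trans
  (shape-Ψ-node (↭-interval-≥ (andreII-word-↭ l (suc k))) (↭-interval-> (size l) (simsun-word-↭ r _)))
  (cong₂ node (shape-andreII-word l (suc k)) (shape-simsun-word r _))

andreI-word-AndreI : ∀ t k → NoLeftOnly t → AndreI (andreI-word t k)
andreI-word-AndreI leaf                k _ = andreI-nil
andreI-word-AndreI (node leaf leaf)    k _ = andreI-single k
andreI-word-AndreI (node (node _ _) leaf) k ()
andreI-word-AndreI (node l (node c d)) k nlo = andreI-split wl k wr above
  (andreI-word-AndreI l (suc k) (proj₁ (NoLeftOnly-node⁻ nlo)))
  (andreI-word-AndreI (node c d) k' (proj₁ (proj₂ (NoLeftOnly-node⁻ nlo))))
  (top , top∈wr , ≤top)
  where
  k' = suc k + size l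
  s = size c + size d
  top = k' + s
  wl = andreI-word l (suc k)
  wr = andreI-word (node c d) k'
  above : All (k <_) (wl ++ wr)
  above = ++⁺ (↭-interval-≥ (andreI-word-↭ l (suc k)))
              (↭-interval-> (size l) (andreI-word-↭ (node c d) k'))
  top∈wr : top ∈ wr
  top∈wr = ∈-resp-↭ (↭-sym (andreI-word-↭ (node c d) k')) (interval-last k' s)
  ≤top : All (_≤ top) (wl ++ wr)
  ≤top = ++⁺ (All.map (λ x<k' → ≤-trans (<⇒≤ x<k') (m≤m+n k' s)) (↭-interval-< (andreI-word-↭ l (suc k))))
             (All.map (λ {x} x< → s≤s⁻¹ (subst (x <_) (+-suc k' s) x<)) (↭-interval-< (andreI-word-↭ (node c d) k')))

andreII-word-AndreII : ∀ t k → NoLeftOnly t → AndreII (andreII-word t k)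
andreII-word-AndreII leaf                k _ = andreII-nil
andreII-word-AndreII (node leaf leaf)    k _ = andreII-single k
andreII-word-AndreII (node (node _ _) leaf) k ()
andreII-word-AndreII (node l (node c d)) k nlo = andreII-split wl k wr above
  (andreII-word-AndreII l (suc k + size r) (proj₁ (NoLeftOnly-node⁻ nlo)))
  (andreII-word-AndreII (node c d) (suc k) (proj₁ (proj₂ (NoLeftOnly-node⁻ nlo))))
  (suc k , ∈-++⁺ʳ (andreII-word c _) (here refl) , above)
  where
  r = node c d
  wl = andreII-word l (suc k + size r)
  wr = andreII-word r (suc k)
  above : All (suc k ≤_) (wl ++ wr)
  above = ++⁺ (↭-interval-> (size r) (andreII-word-↭ l _))
              (↭-interval-≥ (andreII-word-↭ r (suc k)))

filter-≤-above : ∀ {m c xs} → All (m ≤_) xs → ¬ m ≤ c → filter (_≤? c) xs ≡ []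
filter-≤-above {c = c} m≤xs m≰c = filter-none (_≤? c) (All.map (λ m≤x x≤c → m≰c (≤-trans m≤x x≤c)) m≤xs)

filter-≤-split : ∀ c {σ m τ} → All (m <_) σ → All (m <_) τ →
                 filter (_≤? c) (σ ++ m ∷ τ) ≡ filter (_≤? c) σ ++ m ∷ filter (_≤? c) τ
               ⊎ filter (_≤? c) (σ ++ m ∷ τ) ≡ []
filter-≤-split c {σ} {m} {τ} m<σ m<τ with m ≤? c
... | yes m≤c =
  inj₁ (trans (filter-++ (_≤? c) σ (m ∷ τ)) (cong (filter (_≤? c) σ ++_) (filter-accept (_≤? c) m≤c)))
... | no  m≰c = inj₂ (filter-≤-above (++⁺ (All.map <⇒≤ m<σ) (≤-refl ∷ All.map <⇒≤ m<τ)) m≰c)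

filter-≤-≡[] : ∀ {c x xs ys} → x ∈ ys → All (x ≤_) xs → filter (_≤? c) ys ≡ [] → filter (_≤? c) xs ≡ []
filter-≤-≡[] {c} {x} x∈ys x≤xs ys↓≡[] with x ≤? c
... | yes x≤c with () ← subst (x ∈_) ys↓≡[] (∈-filter⁺ (_≤? c) x∈ys x≤c)
... | no  x≰c = filter-≤-above x≤xs x≰c

NoDoubleDescent₀-filter-split : ∀ c {σ m τ} → All (m <_) σ → All (m <_) τ →
  NoDoubleDescent₀ (filter (_≤? c) σ) → NoDoubleDescent₀ (filter (_≤? c) τ) →
  (filter (_≤? c) τ ≡ [] → filter (_≤? c) σ ≡ []) → NoDoubleDescent₀ (filter (_≤? c) (σ ++ m ∷ τ))
NoDoubleDescent₀-filter-split c m<σ m<τ dσ dτ τ↓≡[]⇒σ↓≡[] with filter-≤-split c m<σ m<τ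
... | inj₁ eq =
  subst NoDoubleDescent₀ (sym eq) (NoDoubleDescent₀-split⁺ dσ dτ (filter⁺ (_≤? c) m<τ) τ↓≡[]⇒σ↓≡[])
... | inj₂ eq = subst NoDoubleDescent₀ (sym eq) (tt , tt)

NoDoubleDescent-filter-split : ∀ c {σ m τ} → All (m <_) σ → All (m <_) τ →
  NoDoubleDescent₀ (filter (_≤? c) σ) → NoDoubleDescent (filter (_≤? c) τ) →
  NoDoubleDescent (filter (_≤? c) (σ ++ m ∷ τ))
NoDoubleDescent-filter-split c m<σ m<τ dσ dτ with filter-≤-split c m<σ m<τ
... | inj₁ eq = subst NoDoubleDescent (sym eq) (NoDoubleDescent-split⁺ dσ dτ (filter⁺ (_≤? c) m<τ))
... | inj₂ eq = subst NoDoubleDescent (sym eq) tt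

AndreII⇒NoDoubleDescent₀-filter : ∀ {σ} → AndreII σ → ∀ c → NoDoubleDescent₀ (filter (_≤? c) σ)
AndreII⇒NoDoubleDescent₀-filter andreII-nil        _ = tt , tt
AndreII⇒NoDoubleDescent₀-filter (andreII-single a) c =
  NoDoubleDescent₀-filter-split c {[]} {a} {[]} [] [] (tt , tt) (tt , tt) (λ _ → refl)
AndreII⇒NoDoubleDescent₀-filter (andreII-split τ _ _ m< aτ aτ' (_ , x∈ , x≤)) c =
  NoDoubleDescent₀-filter-split c (++⁻ˡ τ m<) (++⁻ʳ τ m<)
    (AndreII⇒NoDoubleDescent₀-filter aτ c) (AndreII⇒NoDoubleDescent₀-filter aτ' c) (filter-≤-≡[] x∈ (++⁻ˡ τ x≤))

simsun-word-NoDoubleDescent-filter : ∀ t k → NoLeftOnly t → ∀ c →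
                                     NoDoubleDescent (filter (_≤? c) (simsun-word t k))
simsun-word-NoDoubleDescent-filter leaf       k _   _ = tt
simsun-word-NoDoubleDescent-filter (node l r) k nlo c = NoDoubleDescent-filter-split c
  (↭-interval-≥ (andreII-word-↭ l (suc k)))
  (↭-interval-> (size l) (simsun-word-↭ r (suc k + size l)))
  (AndreII⇒NoDoubleDescent₀-filter (andreII-word-AndreII l (suc k) (proj₁ (NoLeftOnly-node⁻ nlo))) c)
  (simsun-word-NoDoubleDescent-filter r _ (proj₁ (proj₂ (NoLeftOnly-node⁻ nlo))) c)

simsun-word-last : ∀ {l r} k → NoLeftOnly (node l r) →
                   ∃[ ρ ] simsun-word (node l r) k ≡ ρ ++ [ k + size l + size r ]
simsun-word-last {l} {leaf} k nlo with refl ← proj₂ (proj₂ (NoLeftOnly-node⁻ nlo)) refl =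
  [] , cong [_] (sym (trans (+-identityʳ (k + 0)) (+-identityʳ k)))
simsun-word-last {l} {node c d} k nlo
  with simsun-word-last (suc k + size l) (proj₁ (proj₂ (NoLeftOnly-node⁻ nlo)))
... | ρ , eq = wl ++ k ∷ ρ , (begin
  wl ++ k ∷ simsun-word (node c d) (suc k + size l)   ≡⟨ cong (λ w → wl ++ k ∷ w) eq ⟩
  wl ++ k ∷ ρ ++ [ suc k + size l + size c + size d ] ≡⟨ ++-assoc wl (k ∷ ρ) _ ⟨
  (wl ++ k ∷ ρ) ++ [ suc k + size l + size c + size d ] ≡⟨ cong (λ x → (wl ++ k ∷ ρ) ++ [ x ]) top≡ ⟩
  (wl ++ k ∷ ρ) ++ [ k + size l + size (node c d) ]     ∎)
  where
  open ≡-Reasoning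
  wl = andreII-word l (suc k)
  top≡ : suc k + size l + size c + size d ≡ k + size l + suc (size c + size d)
  top≡ = trans (cong suc (+-assoc (k + size l) (size c) (size d)))
               (sym (+-suc (k + size l) (size c + size d)))

IsPerm-length : ∀ {n σ} → IsPerm n σ → length σ ≡ n
IsPerm-length {n} p = trans (↭-length p) (trans (length-map suc (upTo n)) (length-upTo n))

IsPerm-≤ : ∀ {n σ} → IsPerm n σ → All (_≤ n) σ
IsPerm-≤ p = All.map s≤s⁻¹ (↭-interval-< (Equivalence.to IsPerm⇔↭-interval p))

shape-Ψ-URL : ∀ {n σ} → IsPerm n σ → NoLeftOnly (shape (Ψ σ)) → URL n (shape (Ψ σ))
shape-Ψ-URL {σ = σ} p nlo = trans (size-shape-Ψ σ) (IsPerm-length p) , nlo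

Simsun⇒NoDoubleDescent₀ : ∀ {n σ} → n ≥ 1 → Simsun n σ → NoDoubleDescent₀ σ
Simsun⇒NoDoubleDescent₀ {n} n≥1 (p , (τ , refl) , d) =
  subst NoDoubleDescent (filter-all (_≤? n) (IsPerm-≤ p)) (d 0 n≥1) ,
  NoFinalDescent-∷ʳ-max (++⁻ˡ τ (IsPerm-≤ p))

URL⇒AndreI : ∀ {n t} → URL n t → ∃[ σ ] (IsPerm n σ × AndreI σ × shape (Ψ σ) ≡ t)
URL⇒AndreI {t = t} (refl , nlo) = andreI-word t 1 ,
  Equivalence.from IsPerm⇔↭-interval (andreI-word-↭ t 1) , andreI-word-AndreI t 1 nlo , shape-andreI-word t 1

URL⇒AndreII : ∀ {n t} → URL n t → ∃[ σ ] (IsPerm n σ × AndreII σ × shape (Ψ σ) ≡ t)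
URL⇒AndreII {t = t} (refl , nlo) = andreII-word t 1 ,
  Equivalence.from IsPerm⇔↭-interval (andreII-word-↭ t 1) , andreII-word-AndreII t 1 nlo , shape-andreII-word t 1

URL⇒Simsun : ∀ {n t} → n ≥ 1 → URL n t → ∃[ σ ] (Simsun n σ × shape (Ψ σ) ≡ t)
URL⇒Simsun {t = leaf} () (refl , _)
URL⇒Simsun {t = t@(node _ _)} _ (refl , nlo) = simsun-word t 1 ,
  (Equivalence.from IsPerm⇔↭-interval (simsun-word-↭ t 1) , simsun-word-last 1 nlo ,
   λ k _ → simsun-word-NoDoubleDescent-filter t 1 nlo (size t ∸ k)) ,
  shape-simsun-word t 1

proposition2p4 : ∀ (n : ℕ) → n ≥ 1 → ∀ (t : Tree) →
    (URL n t ⇔ (∃[ σ ] (IsPerm n σ × AndreI σ × shape (Ψ σ) ≡ t)))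
    × (URL n t ⇔ (∃[ σ ] (IsPerm n σ × AndreII σ × shape (Ψ σ) ≡ t)))
    × (URL n t ⇔ (∃[ σ ] (Simsun n σ × shape (Ψ σ) ≡ t)))
proposition2p4 n n≥1 t =
  mk⇔ URL⇒AndreI (λ { (_ , p , a , refl) → shape-Ψ-URL p (AndreI⇒NoLeftOnly a) }) ,
  mk⇔ URL⇒AndreII (λ { (_ , p , a , refl) → shape-Ψ-URL p (AndreII⇒NoLeftOnly a) }) ,
  mk⇔ (URL⇒Simsun n≥1)
      (λ { (σ , s , refl) → shape-Ψ-URL (proj₁ s) (NoDoubleDescent₀⇒NoLeftOnly σ (Simsun⇒NoDoubleDescent₀ n≥1 s)) })
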